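{- Let $H \in \mathbb{N}$ have Zeckendorf expansion \[ H = F_{m_0} + F_{m_1} + \cdots + F_{m_k}, \] where $k \ge 0$, $m_{i-1} - m_i \ge 2$ for $1 \le i \le k$, and $m_k \ge 2$. Write \[ x_\ell = F_{m_\ell} + \cdots + F_{m_k} \quad (0 \le \ell \le k+1) \] (so $x_{k+1} = 0$), and \[ t_i = \Big\lfloor \frac{m_{i-1} - m_i + 2}{2} \Big\rfloor, \qquad \varepsilon_i = 2t_i - 1 - m_{i-1} + m_i \qquad (1 \le i \le k), \] \[ a_0 = 1, \qquad a_1 = t_1, \qquad a_{\ell+1} = t_{\ell+1} a_\ell - \varepsilon_\ell a_{\ell-1} \quad (1 \le \ell \le k-1). \] Then for $\ell = 1, 2, \ldots, k$ we have \[ A(H) = a_\ell A(x_\ell) - \varepsilon_\ell a_{\ell-1} A(x_{\ell+1}) + \sum_{i \le \ell} a_{i-1} f(t_i)\, 2^{m_{i-1} - 2t_i}. \] In particular \[ A(H) = \begin{cases} a_k \Big\lfloor \frac{2^{m_k}}{6} + \frac{m_k+1}{2} \Big\rfloor - \varepsilon_k a_{k-1} + \displaystyle\sum_{i \le k} a_{i-1} f(t_i)\, 2^{m_{i-1} - 2t_i}, & \text{if } k \ge 1,\\[2mm] \Big\lfloor \frac{2^{m_0}}{6} + \frac{m_0+1}{2} \Big\rfloor, & \text{if } k = 0. \end{cases} \]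
   Context: The Fibonacci numbers are $F_1 = F_2 = 1$, $F_{m+1} = F_m + F_{m-1}$. For $n \in \mathbb{Z}_{\ge 0}$, $R(n)$ is the number of solutions to $x_1 + \cdots + x_s = n$ with $s \in \mathbb{Z}_{\ge 0}$ and $x_1 < \cdots < x_s$ Fibonacci numbers (partitions of $n$ into distinct Fibonacci numbers; $R(0)=1$). For $H \in \mathbb{Z}$, $A(H) = \sum_{n=0}^{H} R(n)$ (so $A(H) = 0$ for $H < 0$). For $t \in \mathbb{N}$, $f(t) = 1 + \frac{2(4^{t-1} - 1)}{3}$. The Zeckendorf expansion of a positive integer is its unique representation as a sum of non-consecutive Fibonacci numbers $F_m$ with indices $m \ge 2$. Empty sums are $0$. -}

module Defs where

open import Data.Nat as ℕ using (ℕ; zero; suc; _≟_; _∸_; _/_)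
open import Data.Integer as ℤ using (ℤ; +_)
open import Data.List using (List; []; _∷_; [_]; _++_; map; filter; length; upTo)
open import Data.Nat.ListAction using (sum)

fib : ℕ → ℕ
fib zero = zero
fib (suc zero) = 1
fib (suc (suc m)) = fib (suc m) ℕ.+ fib m

subsets : List ℕ → List (List ℕ)
subsets [] = [ [] ]
subsets (x ∷ xs) = subsets xs ++ map (x ∷_) (subsets xs)

-- the distinct Fibonacci values F_2 < F_3 < ... < F_{n+2};
-- this contains every Fibonacci number ≤ n (F_m ≥ m - 1)
fibsUpTo : ℕ → List ℕ
fibsUpTo n = map (λ j → fib (2 ℕ.+ j)) (upTo (suc n))

R : ℕ → ℕ
R n = length (filter (λ s → sum s ≟ n) (subsets (fibsUpTo n)))

A : ℕ → ℕ
A H = sum (map R (upTo (suc H)))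

-- f t = 1 + 2 (4^{t-1} - 1) / 3   (exact division for t ≥ 1)
f : ℕ → ℕ
f t = 1 ℕ.+ 2 ℕ.* ((4 ℕ.^ (t ∸ 1) ∸ 1) / 3)

zeckSum : (ℕ → ℕ) → ℕ → ℕ
zeckSum m k = sum (map (λ i → fib (m i)) (upTo (suc k)))

xx : (ℕ → ℕ) → ℕ → ℕ → ℕ
xx m k ℓ = sum (map (λ j → fib (m (ℓ ℕ.+ j))) (upTo (suc k ∸ ℓ)))

tt : (ℕ → ℕ) → ℕ → ℕ
tt m i = (m (i ∸ 1) ∸ m i ℕ.+ 2) / 2

eps : (ℕ → ℕ) → ℕ → ℤ
eps m i = + (2 ℕ.* tt m i) ℤ.- + 1 ℤ.- + m (i ∸ 1) ℤ.+ + m i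

aa : (ℕ → ℕ) → ℕ → ℤ
aa m zero = + 1
aa m (suc zero) = + tt m 1
aa m (suc (suc ℓ)) = + tt m (suc (suc ℓ)) ℤ.* aa m (suc ℓ) ℤ.- eps m (suc ℓ) ℤ.* aa m ℓ

-- Σ_{i=1}^{ℓ} a_{i-1} f(t_i) 2^{m_{i-1} - 2 t_i}
-- (the exponent is ≥ 0 since m_{i-1} - 2t_i ∈ {m_i - 2, m_i - 1})
SS : (ℕ → ℕ) → ℕ → ℤ
SS m ℓ = sum' (map (λ j → aa m j ℤ.* + (f (tt m (suc j)) ℕ.* 2 ℕ.^ (m j ∸ 2 ℕ.* tt m (suc j)))) (upTo ℓ))
  where
  sum' : List ℤ → ℤ
  sum' [] = + 0
  sum' (z ∷ zs) = z ℤ.+ sum' zs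

-- ⌊ 2^m / 6 + (m+1)/2 ⌋ = ⌊ (2^m + 3(m+1)) / 6 ⌋
base : ℕ → ℕ
base m = (2 ℕ.^ m ℕ.+ 3 ℕ.* (m ℕ.+ 1)) / 6

{-# OPTIONS --safe #-}
-- Counting the subsets of {F₂, …, F_{j+1}} with sum at most b gives A(b) whenever b < F_{j+2}.
-- Splitting such counts by whether the largest Fibonacci number is used yields a recursion
-- which, run down the gap between two consecutive Zeckendorf terms in steps of two, gives
-- A(F_n + F_p + y) = t·A(F_p + y) − ε·A(y) + f(t)·2^{n−2t} for y < F_{p−1}: the parity of
-- n − p decides ε ∈ {0, 1}, and the powers of 4 collected along the way add up to f(t).
-- Unrolling this second-order recurrence along the Zeckendorf expansion produces the
-- continuants a_ℓ and the sum of the f(t_i)-terms.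
module Submission where

open import Defs
open import Data.Bool using (true; false; if_then_else_)
open import Data.Nat as ℕ
  using (ℕ; zero; suc; _+_; _*_; _∸_; _^_; _/_; _≤_; _<_; z≤n; s≤s; _≤′_; ≤′-refl; ≤′-step; _≡ᵇ_; _≟_)
open import Data.Nat.Properties
open import Data.Nat.DivMod using (m*n/n≡m; +-distrib-/-∣ʳ)
open import Data.Nat.Divisibility using (n∣m*n)
open import Data.Nat.Tactic.RingSolver using (solve-∀)
open import Function using (_∘′_)
open import Data.Nat.ListAction using (sum)
open import Data.Nat.ListAction.Properties using (sum-++)
open import Data.List using (List; []; _∷_; [_]; _++_; map; foldr; filter; length; upTo)
open import Data.List.Properties
  using (map-++; map-∘; map-upTo; map-cong; map-cong-local; upTo-∷ʳ; length-map; length-upTo; foldr-universal)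
open import Data.List.Membership.Propositional.Properties using (∈-upTo⁻)
import Data.List.Relation.Unary.All as All
open import Relation.Nullary using (does)
open import Data.Sum using (_⊎_; inj₁; inj₂)
open import Data.Product using (_×_; _,_; ∃-syntax)
open import Relation.Unary using (Pred; Decidable)
open import Relation.Binary.PropositionalEquality hiding ([_])
open import Algebra.Properties.CommutativeSemigroup +-commutativeSemigroup
  using (interchange; x∙yz≈y∙xz)
open import Data.Integer as ℤ using (ℤ; +_)
import Data.Integer.Properties as ℤP
open import Data.Integer.Tactic.RingSolver using () renaming (solve-∀ to ℤsolve-∀)

[x+a]+s≡a+[x+s] : ∀ x a s → (x + a) + s ≡ a + (x + s)
[x+a]+s≡a+[x+s] x a s = trans (+-assoc x a s) (x∙yz≈y∙xz x a s)

[m+kn]/n≡m/n+k : ∀ m k n .{{_ : ℕ.NonZero n}} → (m + k * n) / n ≡ m / n + k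
[m+kn]/n≡m/n+k m k n = trans (+-distrib-/-∣ʳ m (n∣m*n k)) (cong (_+_ (m / n)) (m*n/n≡m k n))

+2≤⇒<∸1 : ∀ {a b} → a + 2 ≤ b → suc a ≤ b ∸ 1
+2≤⇒<∸1 {a} {b} a+2≤b =
  subst (_≤ b ∸ 1) (m+n∸n≡m (suc a) 1) (∸-monoˡ-≤ 1 (subst (_≤ b) (+-suc a 1) a+2≤b))

even-or-odd : ∀ d → ∃[ w ] (d ≡ 2 * w ⊎ d ≡ 1 + 2 * w)
even-or-odd zero = 0 , inj₁ refl
even-or-odd (suc d) with even-or-odd d
... | w , inj₁ d≡2w   = w , inj₂ (cong suc d≡2w)
... | w , inj₂ d≡1+2w = suc w , inj₁ (trans (cong suc d≡1+2w) (sym (*-distribˡ-+ 2 1 w)))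

downward-induction : ∀ {ℓ} (P : ℕ → Set ℓ) {k} → P k → (∀ {i} → i < k → P (suc i) → P i) →
  ∀ {i} → i ≤ k → P i
downward-induction P {k} Pk step {i} i≤k = go (k ∸ i) (m∸n+n≡m i≤k)
  where
  go : ∀ d {i} → d + i ≡ k → P i
  go zero    refl = Pk
  go (suc d) {i} d+i≡k =
    step (≤-trans (s≤s (m≤n+m i d)) (≤-reflexive d+i≡k)) (go d (trans (+-suc d i) d+i≡k))

sum-upTo-last : ∀ (g : ℕ → ℕ) n → sum (map g (upTo (suc n))) ≡ sum (map g (upTo n)) + g n
sum-upTo-last g n = begin
  sum (map g (upTo (suc n)))        ≡⟨ cong (sum ∘′ map g) (sym (upTo-∷ʳ n)) ⟩
  sum (map g (upTo n ++ [ n ]))     ≡⟨ cong sum (map-++ g (upTo n) [ n ]) ⟩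
  sum (map g (upTo n) ++ [ g n ])   ≡⟨ sum-++ (map g (upTo n)) [ g n ] ⟩
  sum (map g (upTo n)) + (g n + 0)  ≡⟨ cong (_+_ (sum (map g (upTo n)))) (+-identityʳ (g n)) ⟩
  sum (map g (upTo n)) + g n        ∎
  where open ≡-Reasoning

sum-upTo-first : ∀ (g : ℕ → ℕ) n → sum (map g (upTo (suc n))) ≡ g 0 + sum (map (g ∘′ suc) (upTo n))
sum-upTo-first g n =
  cong sum (trans (map-upTo g (suc n)) (cong (g 0 ∷_) (sym (map-upTo (g ∘′ suc) n))))

length-filter≡sum : ∀ {a p} {A : Set a} {P : Pred A p} (P? : Decidable P) xs →
  length (filter P? xs) ≡ sum (map (λ x → if does (P? x) then 1 else 0) xs)
length-filter≡sum P? []       = refl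
length-filter≡sum P? (x ∷ xs) with does (P? x)
... | true  = cong suc (length-filter≡sum P? xs)
... | false = length-filter≡sum P? xs

foldr-+-∷ʳ : ∀ zs z → foldr ℤ._+_ (+ 0) (zs ++ [ z ]) ≡ foldr ℤ._+_ (+ 0) zs ℤ.+ z
foldr-+-∷ʳ []       z = trans (ℤP.+-identityʳ z) (sym (ℤP.+-identityˡ z))
foldr-+-∷ʳ (y ∷ zs) z = trans (cong (ℤ._+_ y) (foldr-+-∷ʳ zs z)) (sym (ℤP.+-assoc y _ z))

ℕ-identity→ℤ : ∀ {a e y t x q} → a + e * y ≡ t * x + q →
  + a ≡ + t ℤ.* + x ℤ.- + e ℤ.* + y ℤ.+ + q
ℕ-identity→ℤ {a} {e} {y} {t} {x} {q} eq = begin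
  + a                                   ≡⟨ cancel (+ a) (+ e ℤ.* + y) ⟩
  (+ a ℤ.+ + e ℤ.* + y) ℤ.- + e ℤ.* + y ≡⟨ cong (λ u → u ℤ.- + e ℤ.* + y) embedded ⟩
  (+ t ℤ.* + x ℤ.+ + q) ℤ.- + e ℤ.* + y ≡⟨ reorder (+ t ℤ.* + x) (+ q) (+ e ℤ.* + y) ⟩
  + t ℤ.* + x ℤ.- + e ℤ.* + y ℤ.+ + q   ∎
  where
  open ≡-Reasoning
  embed : ∀ m n k → + (m + n * k) ≡ + m ℤ.+ + n ℤ.* + k
  embed m n k = trans (ℤP.pos-+ m (n * k)) (cong (ℤ._+_ (+ m)) (ℤP.pos-* n k))
  embedded : + a ℤ.+ + e ℤ.* + y ≡ + t ℤ.* + x ℤ.+ + q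
  embedded = trans (sym (embed a e y))
    (trans (cong +_ (trans eq (+-comm (t * x) q))) (trans (embed q t x) (ℤP.+-comm (+ q) (+ t ℤ.* + x))))
  cancel : ∀ u v → u ≡ (u ℤ.+ v) ℤ.- v
  cancel = ℤsolve-∀
  reorder : ∀ u v w → (u ℤ.+ v) ℤ.- w ≡ u ℤ.- w ℤ.+ v
  reorder = ℤsolve-∀

ℕ-difference→ℤ : ∀ a b c r → a + c ≡ b + 1 + r → + a ℤ.- + 1 ℤ.- + b ℤ.+ + c ≡ + r
ℕ-difference→ℤ a b c r eq = begin
  + a ℤ.- + 1 ℤ.- + b ℤ.+ + c   ≡⟨ regroup (+ a) (+ b) (+ c) ⟩
  (+ a ℤ.+ + c) ℤ.- (+ b ℤ.+ + 1) ≡⟨ cong₂ (λ u v → u ℤ.- v) (sym (ℤP.pos-+ a c)) (sym (ℤP.pos-+ b 1)) ⟩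
  + (a + c) ℤ.- + (b + 1)       ≡⟨ cong (λ u → + u ℤ.- + (b + 1)) eq ⟩
  + (b + 1 + r) ℤ.- + (b + 1)   ≡⟨ cong (λ u → u ℤ.- + (b + 1)) (ℤP.pos-+ (b + 1) r) ⟩
  + (b + 1) ℤ.+ + r ℤ.- + (b + 1) ≡⟨ cancel (+ (b + 1)) (+ r) ⟩
  + r ∎
  where
  open ≡-Reasoning
  regroup : ∀ u v w → u ℤ.- + 1 ℤ.- v ℤ.+ w ≡ (u ℤ.+ w) ℤ.- (v ℤ.+ + 1)
  regroup = ℤsolve-∀
  cancel : ∀ u v → u ℤ.+ v ℤ.- u ≡ v
  cancel = ℤsolve-∀

Σsubsets : (ℕ → ℕ) → List ℕ → ℕ → ℕ
Σsubsets g []       a = g a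
Σsubsets g (x ∷ xs) a = Σsubsets g xs a + Σsubsets g xs (x + a)

Σsubsets-cong : ∀ {g h} → (∀ c → g c ≡ h c) → ∀ L a → Σsubsets g L a ≡ Σsubsets h L a
Σsubsets-cong g≗h []       a = g≗h a
Σsubsets-cong g≗h (x ∷ xs) a = cong₂ _+_ (Σsubsets-cong g≗h xs a) (Σsubsets-cong g≗h xs (x + a))

Σsubsets-+ : ∀ g h L a →
  Σsubsets (λ c → g c + h c) L a ≡ Σsubsets g L a + Σsubsets h L a
Σsubsets-+ g h []       a = refl
Σsubsets-+ g h (x ∷ xs) a =
  trans (cong₂ _+_ (Σsubsets-+ g h xs a) (Σsubsets-+ g h xs (x + a)))
        (interchange (Σsubsets g xs a) _ _ _)

Σsubsets-shift : ∀ g L d a → Σsubsets g L (d + a) ≡ Σsubsets (λ c → g (d + c)) L a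
Σsubsets-shift g []       d a = refl
Σsubsets-shift g (x ∷ xs) d a = cong₂ _+_ (Σsubsets-shift g xs d a)
  (trans (cong (Σsubsets g xs) (x∙yz≈y∙xz x d a)) (Σsubsets-shift g xs d (x + a)))

Σsubsets-∷ʳ : ∀ g L y a → Σsubsets g (L ++ [ y ]) a ≡ Σsubsets g L a + Σsubsets g L (y + a)
Σsubsets-∷ʳ g []       y a = refl
Σsubsets-∷ʳ g (x ∷ xs) y a = begin
  Σsubsets g (xs ++ [ y ]) a + Σsubsets g (xs ++ [ y ]) (x + a)
    ≡⟨ cong₂ _+_ (Σsubsets-∷ʳ g xs y a) (Σsubsets-∷ʳ g xs y (x + a)) ⟩
  (Σsubsets g xs a + Σsubsets g xs (y + a)) + (Σsubsets g xs (x + a) + Σsubsets g xs (y + (x + a)))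
    ≡⟨ interchange (Σsubsets g xs a) _ _ _ ⟩
  (Σsubsets g xs a + Σsubsets g xs (x + a)) + (Σsubsets g xs (y + a) + Σsubsets g xs (y + (x + a)))
    ≡⟨ cong (λ b → (Σsubsets g xs a + Σsubsets g xs (x + a)) + (Σsubsets g xs (y + a) + Σsubsets g xs b))
            (x∙yz≈y∙xz y x a) ⟩
  (Σsubsets g xs a + Σsubsets g xs (x + a)) + (Σsubsets g xs (y + a) + Σsubsets g xs (x + (y + a))) ∎
  where open ≡-Reasoning

Σsubsets-vanish : ∀ {g} L a → (∀ c → a ≤ c → g c ≡ 0) → Σsubsets g L a ≡ 0
Σsubsets-vanish []       a g≡0 = g≡0 a ≤-refl
Σsubsets-vanish (x ∷ xs) a g≡0 = cong₂ _+_ (Σsubsets-vanish xs a g≡0)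
  (Σsubsets-vanish xs (x + a) (λ c x+a≤c → g≡0 c (≤-trans (m≤n+m a x) x+a≤c)))

Σsubsets-const : ∀ {g} L a → (∀ c → c ≤ a + sum L → g c ≡ 1) → Σsubsets g L a ≡ 2 ^ length L
Σsubsets-const []       a g≡1 = g≡1 a (≤-reflexive (sym (+-identityʳ a)))
Σsubsets-const (x ∷ xs) a g≡1 = begin
  Σsubsets _ xs a + Σsubsets _ xs (x + a)
    ≡⟨ cong₂ _+_ (Σsubsets-const xs a (λ c c≤ → g≡1 c (≤-trans c≤ without-x)))
                 (Σsubsets-const xs (x + a) (λ c c≤ → g≡1 c (≤-trans c≤ with-x))) ⟩
  2 ^ length xs + 2 ^ length xs
    ≡⟨ cong (_+_ (2 ^ length xs)) (sym (+-identityʳ _)) ⟩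
  2 ^ length (x ∷ xs) ∎
  where
  open ≡-Reasoning
  without-x : a + sum xs ≤ a + sum (x ∷ xs)
  without-x = +-monoʳ-≤ a (m≤n+m (sum xs) x)
  with-x : (x + a) + sum xs ≤ a + sum (x ∷ xs)
  with-x = ≤-reflexive ([x+a]+s≡a+[x+s] x a (sum xs))

Σsubsets≡sum-subsets : ∀ g L a → Σsubsets g L a ≡ sum (map (λ s → g (a + sum s)) (subsets L))
Σsubsets≡sum-subsets g []       a = sym (trans (+-identityʳ _) (cong g (+-identityʳ a)))
Σsubsets≡sum-subsets g (x ∷ xs) a = begin
  Σsubsets g xs a + Σsubsets g xs (x + a)
    ≡⟨ cong₂ _+_ (Σsubsets≡sum-subsets g xs a) (Σsubsets≡sum-subsets g xs (x + a)) ⟩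
  sum (map h (subsets xs)) + sum (map (λ s → g ((x + a) + sum s)) (subsets xs))
    ≡⟨ cong (λ l → sum (map h (subsets xs)) + sum l)
            (trans (map-cong (λ s → cong g ([x+a]+s≡a+[x+s] x a (sum s))) (subsets xs)) (map-∘ (subsets xs))) ⟩
  sum (map h (subsets xs)) + sum (map h (map (x ∷_) (subsets xs)))
    ≡⟨ sym (sum-++ (map h (subsets xs)) _) ⟩
  sum (map h (subsets xs) ++ map h (map (x ∷_) (subsets xs)))
    ≡⟨ cong sum (sym (map-++ h (subsets xs) _)) ⟩
  sum (map h (subsets (x ∷ xs))) ∎
  where
  open ≡-Reasoning
  h = λ s → g (a + sum s)

sum-Σsubsets : ∀ (g : ℕ → ℕ → ℕ) ns L a →
  sum (map (λ n → Σsubsets (g n) L a) ns) ≡ Σsubsets (λ c → sum (map (λ n → g n c) ns)) L a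
sum-Σsubsets g []       L a = sym (Σsubsets-vanish L a (λ _ _ → refl))
sum-Σsubsets g (n ∷ ns) L a =
  trans (cong (_+_ (Σsubsets (g n) L a)) (sum-Σsubsets g ns L a))
        (sym (Σsubsets-+ (g n) (λ c → sum (map (λ n → g n c) ns)) L a))

δ : ℕ → ℕ → ℕ
δ n c = if c ≡ᵇ n then 1 else 0

χ≤ : ℕ → ℕ → ℕ
χ≤ b       zero    = 1
χ≤ zero    (suc c) = 0
χ≤ (suc b) (suc c) = χ≤ b c

δ-vanish : ∀ {n c} → n < c → δ n c ≡ 0
δ-vanish {zero}  {suc c} _         = refl
δ-vanish {suc n} {suc c} (s≤s n<c) = δ-vanish n<c

χ≤-vanish : ∀ {b c} → b < c → χ≤ b c ≡ 0
χ≤-vanish {zero}  {suc c} _         = refl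
χ≤-vanish {suc b} {suc c} (s≤s b<c) = χ≤-vanish b<c

χ≤-one : ∀ {b c} → c ≤ b → χ≤ b c ≡ 1
χ≤-one {b}     {zero}  _         = refl
χ≤-one {suc b} {suc c} (s≤s c≤b) = χ≤-one c≤b

χ≤-shift : ∀ d b c → χ≤ (d + b) (d + c) ≡ χ≤ b c
χ≤-shift zero    b c = refl
χ≤-shift (suc d) b c = χ≤-shift d b c

χ≤-suc : ∀ b c → χ≤ (suc b) c ≡ χ≤ b c + δ (suc b) c
χ≤-suc b       zero          = refl
χ≤-suc zero    (suc zero)    = refl
χ≤-suc zero    (suc (suc c)) = refl
χ≤-suc (suc b) (suc c)       = χ≤-suc b c

sum-δ≡χ≤ : ∀ y c → sum (map (λ n → δ n c) (upTo (suc y))) ≡ χ≤ y c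
sum-δ≡χ≤ zero    zero    = refl
sum-δ≡χ≤ zero    (suc c) = refl
sum-δ≡χ≤ (suc y) c = begin
  sum (map (λ n → δ n c) (upTo (suc (suc y))))   ≡⟨ sum-upTo-last (λ n → δ n c) (suc y) ⟩
  sum (map (λ n → δ n c) (upTo (suc y))) + δ (suc y) c ≡⟨ cong (_+ δ (suc y) c) (sum-δ≡χ≤ y c) ⟩
  χ≤ y c + δ (suc y) c                           ≡⟨ sym (χ≤-suc y c) ⟩
  χ≤ (suc y) c                                   ∎
  where open ≡-Reasoning

fib-mono : ∀ {m n} → m ≤ n → fib m ≤ fib n
fib-mono m≤n = go (≤⇒≤′ m≤n)
  where
  fib-step : ∀ n → fib n ≤ fib (suc n)
  fib-step zero          = z≤n
  fib-step (suc zero)    = ≤-refl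
  fib-step (suc (suc n)) = m≤m+n _ _
  go : ∀ {m n} → m ≤′ n → fib m ≤ fib n
  go ≤′-refl        = ≤-refl
  go (≤′-step {n} m≤′n) = ≤-trans (go m≤′n) (fib-step n)

fib-pos : ∀ n → 0 < fib (suc n)
fib-pos zero    = ≤-refl
fib-pos (suc n) = ≤-trans (fib-pos n) (m≤m+n _ _)

n<fib[2+n] : ∀ n → n < fib (2 + n)
n<fib[2+n] zero    = ≤-refl
n<fib[2+n] (suc n) = ≤-trans (≤-reflexive (+-comm 1 (suc n))) (+-mono-≤ (n<fib[2+n] n) (fib-pos n))

fib-tail : ∀ {M z} → 1 ≤ M → z < fib (M ∸ 1) → fib M + z < fib (suc M)
fib-tail {suc M} _ z<F = +-monoʳ-< (fib (suc M)) z<F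

fibs : ℕ → List ℕ
fibs j = map (λ i → fib (2 + i)) (upTo j)

fibs-suc : ∀ j → fibs (suc j) ≡ fibs j ++ [ fib (2 + j) ]
fibs-suc j = trans (cong (map (λ i → fib (2 + i))) (sym (upTo-∷ʳ j))) (map-++ _ (upTo j) [ j ])

length-fibs : ∀ j → length (fibs j) ≡ j
length-fibs j = trans (length-map _ (upTo j)) (length-upTo j)

sum-fibs : ∀ j → sum (fibs j) + 2 ≡ fib (3 + j)
sum-fibs zero    = refl
sum-fibs (suc j) = begin
  sum (fibs (suc j)) + 2      ≡⟨ cong (λ l → sum l + 2) (fibs-suc j) ⟩
  sum (fibs j ++ [ F ]) + 2   ≡⟨ cong (_+ 2) (sum-++ (fibs j) [ F ]) ⟩
  sum (fibs j) + (F + 0) + 2  ≡⟨ regroup (sum (fibs j)) F ⟩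
  sum (fibs j) + 2 + F        ≡⟨ cong (_+ F) (sum-fibs j) ⟩
  fib (3 + j) + F             ∎
  where
  open ≡-Reasoning
  F = fib (2 + j)
  regroup : ∀ s F → s + (F + 0) + 2 ≡ s + 2 + F
  regroup = solve-∀

Σsubsets-fibs-stable : ∀ {g i j} → i ≤ j → (∀ c → fib (2 + i) ≤ c → g c ≡ 0) →
  Σsubsets g (fibs j) 0 ≡ Σsubsets g (fibs i) 0
Σsubsets-fibs-stable {g} {i} i≤j g≡0 = go (≤⇒≤′ i≤j)
  where
  go : ∀ {j} → i ≤′ j → Σsubsets g (fibs j) 0 ≡ Σsubsets g (fibs i) 0
  go ≤′-refl = refl
  go (≤′-step {j} i≤′j) = begin
    Σsubsets g (fibs (suc j)) 0
      ≡⟨ cong (λ l → Σsubsets g l 0) (fibs-suc j) ⟩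
    Σsubsets g (fibs j ++ [ fib (2 + j) ]) 0
      ≡⟨ Σsubsets-∷ʳ g (fibs j) (fib (2 + j)) 0 ⟩
    Σsubsets g (fibs j) 0 + Σsubsets g (fibs j) (fib (2 + j) + 0)
      ≡⟨ cong₂ _+_ (go i≤′j) (Σsubsets-vanish (fibs j) _ (λ c F≤c →
           g≡0 c (≤-trans (fib-mono (s≤s (s≤s (≤′⇒≤ i≤′j)))) (≤-trans (m≤m+n _ 0) F≤c)))) ⟩
    Σsubsets g (fibs i) 0 + 0
      ≡⟨ +-identityʳ _ ⟩
    Σsubsets g (fibs i) 0 ∎
    where open ≡-Reasoning

R≡Σsubsets : ∀ n → R n ≡ Σsubsets (δ n) (fibs (suc n)) 0
R≡Σsubsets n = trans (length-filter≡sum (λ s → sum s ≟ n) (subsets (fibs (suc n))))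
                     (sym (Σsubsets≡sum-subsets (δ n) (fibs (suc n)) 0))

count≤ : ℕ → ℕ → ℕ → ℕ
count≤ j a b = Σsubsets (χ≤ b) (fibs j) a

count≤-suc : ∀ j a b → count≤ (suc j) a b ≡ count≤ j a b + count≤ j (fib (2 + j) + a) b
count≤-suc j a b = trans (cong (λ l → Σsubsets (χ≤ b) l a) (fibs-suc j)) (Σsubsets-∷ʳ (χ≤ b) (fibs j) _ a)

count≤-shift : ∀ j d a b → count≤ j (d + a) (d + b) ≡ count≤ j a b
count≤-shift j d a b =
  trans (Σsubsets-shift (χ≤ (d + b)) (fibs j) d a) (Σsubsets-cong (χ≤-shift d b) (fibs j) a)

count≤-full : ∀ j a b → a + fib (3 + j) ≤ b + 2 → count≤ j a b ≡ 2 ^ j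
count≤-full j a b a+F≤b+2 =
  trans (Σsubsets-const (fibs j) a (λ c c≤ → χ≤-one (≤-trans c≤ a+Σ≤b))) (cong (2 ^_) (length-fibs j))
  where
  a+Σ≤b : a + sum (fibs j) ≤ b
  a+Σ≤b = +-cancelʳ-≤ 2 _ _ (subst (_≤ b + 2)
            (trans (cong (_+_ a) (sym (sum-fibs j))) (sym (+-assoc a _ 2))) a+F≤b+2)

count≤-stable : ∀ {i j y} → i ≤ j → y < fib (2 + i) → count≤ j 0 y ≡ count≤ i 0 y
count≤-stable i≤j y<F = Σsubsets-fibs-stable i≤j (λ c F≤c → χ≤-vanish (<-≤-trans y<F F≤c))

A≡count≤ : ∀ j y → y < fib (2 + j) → A y ≡ count≤ j 0 y
A≡count≤ j y y<F = begin
  sum (map R (upTo (suc y)))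
    ≡⟨ cong sum (map-cong-local (All.tabulate (λ n∈ → R≡Σsubsets-below (∈-upTo⁻ n∈)))) ⟩
  sum (map (λ n → Σsubsets (δ n) (fibs (suc y)) 0) (upTo (suc y)))
    ≡⟨ sum-Σsubsets δ (upTo (suc y)) (fibs (suc y)) 0 ⟩
  Σsubsets (λ c → sum (map (λ n → δ n c) (upTo (suc y)))) (fibs (suc y)) 0
    ≡⟨ Σsubsets-cong (sum-δ≡χ≤ y) (fibs (suc y)) 0 ⟩
  count≤ (suc y) 0 y
    ≡⟨ restrict (≤-total j (suc y)) ⟩
  count≤ j 0 y ∎
  where
  open ≡-Reasoning
  R≡Σsubsets-below : ∀ {n} → n < suc y → R n ≡ Σsubsets (δ n) (fibs (suc y)) 0
  R≡Σsubsets-below {n} (s≤s n≤y) = trans (R≡Σsubsets n) (sym (Σsubsets-fibs-stable (s≤s n≤y)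
    (λ c F≤c → δ-vanish (<-≤-trans (n<fib[2+n] n) (≤-trans (fib-mono (n≤1+n (2 + n))) F≤c)))))
  restrict : j ≤ suc y ⊎ suc y ≤ j → count≤ (suc y) 0 y ≡ count≤ j 0 y
  restrict (inj₁ j≤) = count≤-stable j≤ y<F
  restrict (inj₂ ≤j) = sym (count≤-stable ≤j (<-≤-trans (n<fib[2+n] y) (fib-mono (n≤1+n (2 + y)))))

-- Equal to A (fib (suc i) + x) only for x < fib i (A≡count≤top), but the recursion
-- count≤top-+2 is also needed beyond that range.
count≤top : ℕ → ℕ → ℕ
count≤top i x = count≤ i 0 (fib (suc i) + x)

A≡count≤top : ∀ i x → x < fib i → A (fib (suc i) + x) ≡ count≤top i x
A≡count≤top i x x<F = A≡count≤ i _ (+-monoʳ-< (fib (suc i)) x<F)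

count≤top-full : ∀ i y → count≤top i (fib (2 + i) + y) ≡ 2 ^ i
count≤top-full i y = count≤-full i 0 _
  (≤-trans (≤-reflexive (+-comm (fib (2 + i)) (fib (1 + i))))
    (≤-trans (+-monoʳ-≤ (fib (1 + i)) (m≤m+n (fib (2 + i)) y)) (m≤m+n _ 2)))

count≤top-+2 : ∀ i x → count≤top (2 + i) x ≡ 2 ^ i + count≤top i x + count≤ (1 + i) 0 x
count≤top-+2 i x = begin
  count≤ (2 + i) 0 (F₃ + x)
    ≡⟨ count≤-suc (1 + i) 0 (F₃ + x) ⟩
  count≤ (1 + i) 0 (F₃ + x) + count≤ (1 + i) (F₃ + 0) (F₃ + x)
    ≡⟨ cong₂ _+_ (count≤-suc i 0 (F₃ + x)) (count≤-shift (1 + i) F₃ 0 x) ⟩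
  count≤ i 0 (F₃ + x) + count≤ i (F₂ + 0) (F₂ + F₁ + x) + count≤ (1 + i) 0 x
    ≡⟨ cong (λ z → count≤ i 0 (F₃ + x) + count≤ i (F₂ + 0) z + count≤ (1 + i) 0 x) (+-assoc F₂ F₁ x) ⟩
  count≤ i 0 (F₃ + x) + count≤ i (F₂ + 0) (F₂ + (F₁ + x)) + count≤ (1 + i) 0 x
    ≡⟨ cong₂ (λ u v → u + v + count≤ (1 + i) 0 x)
             (count≤-full i 0 (F₃ + x) (≤-trans (m≤m+n F₃ x) (m≤m+n _ 2)))
             (count≤-shift i F₂ 0 (F₁ + x)) ⟩
  2 ^ i + count≤top i x + count≤ (1 + i) 0 x ∎
  where
  open ≡-Reasoning
  F₁ = fib (1 + i)
  F₂ = fib (2 + i)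
  F₃ = fib (3 + i)

count≤top-suc : ∀ p y → y < fib (1 + p) →
  count≤top (1 + p) (fib (2 + p) + y) + A y ≡ 2 ^ p + A (fib (2 + p) + y)
count≤top-suc p y y<F = begin
  count≤ (1 + p) 0 (F₂ + x) + A y
    ≡⟨ cong (_+ A y) (count≤-suc p 0 (F₂ + x)) ⟩
  count≤ p 0 (F₂ + x) + count≤ p (F₂ + 0) (F₂ + x) + A y
    ≡⟨ cong₂ (λ u v → u + v + A y) (count≤-full p 0 (F₂ + x) F₃≤) (count≤-shift p F₂ 0 x) ⟩
  2 ^ p + count≤ p 0 x + A y
    ≡⟨ +-assoc (2 ^ p) _ _ ⟩
  2 ^ p + (count≤ p 0 x + A y)
    ≡⟨ cong (λ z → 2 ^ p + (count≤ p 0 x + z))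
            (trans (A≡count≤ p y (<-≤-trans y<F (fib-mono (n≤1+n (1 + p))))) (sym (count≤-shift p F₂ 0 y))) ⟩
  2 ^ p + (count≤ p 0 x + count≤ p (F₂ + 0) (F₂ + y))
    ≡⟨ cong (_+_ (2 ^ p)) (sym (count≤-suc p 0 x)) ⟩
  2 ^ p + count≤ (1 + p) 0 x
    ≡⟨ cong (_+_ (2 ^ p)) (sym (A≡count≤ (1 + p) x (+-monoʳ-< F₂ y<F))) ⟩
  2 ^ p + A x ∎
  where
  open ≡-Reasoning
  F₂ = fib (2 + p)
  x = F₂ + y
  F₃≤ : 0 + fib (3 + p) ≤ F₂ + x + 2
  F₃≤ = ≤-trans (+-monoʳ-≤ F₂ (≤-trans (fib-mono (n≤1+n (1 + p))) (m≤m+n F₂ y))) (m≤m+n _ 2)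

repunit₄ : ℕ → ℕ
repunit₄ zero    = 0
repunit₄ (suc u) = 1 + 4 * repunit₄ u

4^≡1+3*repunit₄ : ∀ u → 4 ^ u ≡ 1 + 3 * repunit₄ u
4^≡1+3*repunit₄ zero    = refl
4^≡1+3*repunit₄ (suc u) = trans (cong (4 *_) (4^≡1+3*repunit₄ u)) (shift-digit (repunit₄ u))
  where
  shift-digit : ∀ r → 4 * (1 + 3 * r) ≡ 1 + 3 * (1 + 4 * r)
  shift-digit = solve-∀

f-suc : ∀ t → f (suc t) ≡ 1 + 2 * repunit₄ t
f-suc t = cong (λ z → 1 + 2 * z) (begin
  (4 ^ t ∸ 1) / 3            ≡⟨ cong (λ z → (z ∸ 1) / 3) (4^≡1+3*repunit₄ t) ⟩
  (3 * repunit₄ t) / 3       ≡⟨ cong (_/ 3) (*-comm 3 (repunit₄ t)) ⟩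
  (repunit₄ t * 3) / 3       ≡⟨ m*n/n≡m (repunit₄ t) 3 ⟩
  repunit₄ t                 ∎)
  where open ≡-Reasoning

count≤top-iterate : ∀ u q x → x < fib (3 + q) →
  count≤top (q + 2 * u) x ≡ count≤top q x + u * A x + 2 ^ q * repunit₄ u
count≤top-iterate zero q x _ =
  trans (cong (λ i → count≤top i x) (+-identityʳ q)) (pad (count≤top q x) (2 ^ q))
  where
  pad : ∀ c P → c ≡ c + 0 + P * 0
  pad = solve-∀
count≤top-iterate (suc u) q x x<F = begin
  count≤top (q + 2 * suc u) x
    ≡⟨ cong (λ i → count≤top i x) (reindex q u) ⟩
  count≤top ((2 + q) + 2 * u) x
    ≡⟨ count≤top-iterate u (2 + q) x (<-≤-trans x<F (fib-mono (+-monoʳ-≤ 3 (m≤n+m q 2)))) ⟩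
  count≤top (2 + q) x + u * A x + 2 ^ (2 + q) * r
    ≡⟨ cong (λ z → z + u * A x + 2 ^ (2 + q) * r) (count≤top-+2 q x) ⟩
  2 ^ q + count≤top q x + count≤ (1 + q) 0 x + u * A x + 2 ^ (2 + q) * r
    ≡⟨ cong (λ z → 2 ^ q + count≤top q x + z + u * A x + 2 ^ (2 + q) * r) (sym (A≡count≤ (1 + q) x x<F)) ⟩
  2 ^ q + count≤top q x + A x + u * A x + 2 ^ (2 + q) * r
    ≡⟨ collect (2 ^ q) (count≤top q x) (A x) u r ⟩
  count≤top q x + suc u * A x + 2 ^ q * repunit₄ (suc u) ∎
  where
  open ≡-Reasoning
  r = repunit₄ u
  reindex : ∀ q u → q + 2 * suc u ≡ (2 + q) + 2 * u
  reindex = solve-∀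
  collect : ∀ P c a u r → P + c + a + u * a + 2 * (2 * P) * r ≡ c + suc u * a + P * (1 + 4 * r)
  collect = solve-∀

A-gap-even : ∀ p w y → y < fib (1 + p) →
  A (fib (4 + p + 2 * w) + (fib (2 + p) + y)) + A y ≡ (2 + w) * A (fib (2 + p) + y) + f (2 + w) * 2 ^ p
A-gap-even p w y y<F = begin
  A (fib (4 + p + 2 * w) + x) + A y
    ≡⟨ cong (_+ A y) (A≡count≤top (3 + p + 2 * w) x (<-≤-trans x<F (fib-mono (m≤m+n (3 + p) (2 * w))))) ⟩
  count≤top (3 + p + 2 * w) x + A y
    ≡⟨ cong (λ i → count≤top i x + A y) (reindex p w) ⟩
  count≤top ((1 + p) + 2 * suc w) x + A y
    ≡⟨ cong (_+ A y) (count≤top-iterate (suc w) (1 + p) x (<-≤-trans x<F (fib-mono (n≤1+n (3 + p))))) ⟩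
  count≤top (1 + p) x + suc w * A x + 2 ^ (1 + p) * r + A y
    ≡⟨ regroup (count≤top (1 + p) x) (suc w * A x) (2 ^ (1 + p) * r) (A y) ⟩
  (count≤top (1 + p) x + A y) + suc w * A x + 2 ^ (1 + p) * r
    ≡⟨ cong (λ z → z + suc w * A x + 2 ^ (1 + p) * r) (count≤top-suc p y y<F) ⟩
  2 ^ p + A x + suc w * A x + 2 * 2 ^ p * r
    ≡⟨ collect (2 ^ p) (A x) w r ⟩
  (2 + w) * A x + (1 + 2 * r) * 2 ^ p
    ≡⟨ cong (λ z → (2 + w) * A x + z * 2 ^ p) (sym (f-suc (suc w))) ⟩
  (2 + w) * A x + f (2 + w) * 2 ^ p ∎
  where
  open ≡-Reasoning
  x = fib (2 + p) + y
  x<F : x < fib (3 + p)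
  x<F = +-monoʳ-< (fib (2 + p)) y<F
  r = repunit₄ (suc w)
  reindex : ∀ p w → 3 + p + 2 * w ≡ (1 + p) + 2 * suc w
  reindex = solve-∀
  regroup : ∀ c v s a → c + v + s + a ≡ (c + a) + v + s
  regroup = solve-∀
  collect : ∀ P a w r → P + a + suc w * a + 2 * P * r ≡ (2 + w) * a + (1 + 2 * r) * P
  collect = solve-∀

A-gap-odd : ∀ p w y → y < fib (1 + p) →
  A (fib (5 + p + 2 * w) + (fib (2 + p) + y)) ≡ (2 + w) * A (fib (2 + p) + y) + f (2 + w) * 2 ^ (1 + p)
A-gap-odd p w y y<F = begin
  A (fib (5 + p + 2 * w) + x)
    ≡⟨ A≡count≤top (4 + p + 2 * w) x
         (<-≤-trans x<F (fib-mono (≤-trans (n≤1+n (3 + p)) (m≤m+n (4 + p) (2 * w))))) ⟩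
  count≤top (4 + p + 2 * w) x
    ≡⟨ cong (λ i → count≤top i x) (reindex p w) ⟩
  count≤top (p + 2 * (2 + w)) x
    ≡⟨ count≤top-iterate (2 + w) p x x<F ⟩
  count≤top p x + (2 + w) * A x + 2 ^ p * repunit₄ (2 + w)
    ≡⟨ cong (λ z → z + (2 + w) * A x + 2 ^ p * repunit₄ (2 + w)) (count≤top-full p y) ⟩
  2 ^ p + (2 + w) * A x + 2 ^ p * (1 + 4 * r)
    ≡⟨ collect (2 ^ p) (A x) w r ⟩
  (2 + w) * A x + (1 + 2 * r) * (2 * 2 ^ p)
    ≡⟨ cong (λ z → (2 + w) * A x + z * 2 ^ (1 + p)) (sym (f-suc (suc w))) ⟩
  (2 + w) * A x + f (2 + w) * 2 ^ (1 + p) ∎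
  where
  open ≡-Reasoning
  x = fib (2 + p) + y
  x<F : x < fib (3 + p)
  x<F = +-monoʳ-< (fib (2 + p)) y<F
  r = repunit₄ (suc w)
  reindex : ∀ p w → 4 + p + 2 * w ≡ p + 2 * (2 + w)
  reindex = solve-∀
  collect : ∀ P a w r → P + (2 + w) * a + P * (1 + 4 * r) ≡ (2 + w) * a + (1 + 2 * r) * (2 * P)
  collect = solve-∀

A-fib : ∀ M → 2 ≤ M → A (fib M) ≡ base M
A-fib 1 (s≤s ())
A-fib 2 _ = refl
A-fib 3 _ = refl
A-fib (suc (suc (suc (suc j)))) _ = begin
  A (fib (4 + j))
    ≡⟨ cong A (sym (+-identityʳ (fib (4 + j)))) ⟩
  A (fib (4 + j) + 0)
    ≡⟨ A≡count≤top (3 + j) 0 (fib-pos (2 + j)) ⟩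
  count≤top (3 + j) 0
    ≡⟨ count≤top-+2 (1 + j) 0 ⟩
  2 ^ (1 + j) + count≤top (1 + j) 0 + count≤ (2 + j) 0 0
    ≡⟨ cong₂ (λ u v → 2 ^ (1 + j) + u + v) (sym (A≡count≤top (1 + j) 0 (fib-pos j)))
                                           (sym (A≡count≤ (2 + j) 0 (fib-pos (3 + j)))) ⟩
  2 ^ (1 + j) + A (fib (2 + j) + 0) + 1
    ≡⟨ cong (λ z → 2 ^ (1 + j) + A z + 1) (+-identityʳ (fib (2 + j))) ⟩
  2 ^ (1 + j) + A (fib (2 + j)) + 1
    ≡⟨ cong (λ z → 2 ^ (1 + j) + z + 1) (A-fib (suc (suc j)) (s≤s (s≤s z≤n))) ⟩
  2 ^ (1 + j) + base (2 + j) + 1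
    ≡⟨ regroup (2 ^ j) (base (2 + j)) ⟩
  base (2 + j) + (2 ^ (1 + j) + 1)
    ≡⟨ sym ([m+kn]/n≡m/n+k (2 ^ (2 + j) + 3 * (2 + j + 1)) (2 ^ (1 + j) + 1) 6) ⟩
  (2 ^ (2 + j) + 3 * (2 + j + 1) + (2 ^ (1 + j) + 1) * 6) / 6
    ≡⟨ cong (_/ 6) (numerator (2 ^ j) j) ⟩
  base (4 + j) ∎
  where
  open ≡-Reasoning
  regroup : ∀ P b → 2 * P + b + 1 ≡ b + (2 * P + 1)
  regroup = solve-∀
  numerator : ∀ P j →
    2 * (2 * P) + 3 * (2 + j + 1) + (2 * P + 1) * 6 ≡ 2 * (2 * (2 * (2 * P))) + 3 * (4 + j + 1)
  numerator = solve-∀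

-- tt m (suc ℓ) and eps m (suc ℓ) unfold to gapT (m ℓ) (m (suc ℓ)) and gapε (m ℓ) (m (suc ℓ)).
gapT : ℕ → ℕ → ℕ
gapT n p = (n ∸ p + 2) / 2

gapε : ℕ → ℕ → ℤ
gapε n p = + (2 * gapT n p) ℤ.- + 1 ℤ.- + n ℤ.+ + p

Recurrence : ℕ → ℕ → ℕ → Set
Recurrence n p y = + A (fib n + (fib p + y)) ≡
  + gapT n p ℤ.* + A (fib p + y) ℤ.- gapε n p ℤ.* + A y ℤ.+ + (f (gapT n p) * 2 ^ (n ∸ 2 * gapT n p))

recurrence-from-ℕ : ∀ n p y {t e k} → gapT n p ≡ t → gapε n p ≡ + e → n ∸ 2 * t ≡ k →
  A (fib n + (fib p + y)) + e * A y ≡ t * A (fib p + y) + f t * 2 ^ k → Recurrence n p y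
recurrence-from-ℕ n p y {e = e} refl ε≡e refl eq rewrite ε≡e =
  ℕ-identity→ℤ {e = e} {y = A y} {t = gapT n p} {x = A (fib p + y)} eq

gapT-+ : ∀ p g → gapT (p + g) p ≡ (g + 2) / 2
gapT-+ p g = cong (λ d → (d + 2) / 2) (m+n∸m≡n p g)

recurrence-even-gap : ∀ p w y → y < fib (1 + p) → Recurrence (4 + p + 2 * w) (2 + p) y
recurrence-even-gap p w y y<F =
  recurrence-from-ℕ n (2 + p) y t≡ ε≡ exponent≡
    (trans (cong (_+_ (A (fib n + (fib (2 + p) + y)))) (*-identityˡ (A y))) (A-gap-even p w y y<F))
  where
  n = 4 + p + 2 * w
  t≡ : gapT n (2 + p) ≡ 2 + w
  t≡ = begin
    gapT n (2 + p)                        ≡⟨ cong (λ n → gapT n (2 + p)) (split p w) ⟩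
    gapT ((2 + p) + (2 + 2 * w)) (2 + p)  ≡⟨ gapT-+ (2 + p) (2 + 2 * w) ⟩
    (2 + 2 * w + 2) / 2                   ≡⟨ cong (_/ 2) (halve w) ⟩
    (2 + w) * 2 / 2                       ≡⟨ m*n/n≡m (2 + w) 2 ⟩
    2 + w                                 ∎
    where
    open ≡-Reasoning
    split : ∀ p w → 4 + p + 2 * w ≡ (2 + p) + (2 + 2 * w)
    split = solve-∀
    halve : ∀ w → 2 + 2 * w + 2 ≡ (2 + w) * 2
    halve = solve-∀
  ε≡ : gapε n (2 + p) ≡ + 1
  ε≡ = trans (cong (λ t → + (2 * t) ℤ.- + 1 ℤ.- + n ℤ.+ + (2 + p)) t≡)
             (ℕ-difference→ℤ (2 * (2 + w)) n (2 + p) 1 (balance p w))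
    where
    balance : ∀ p w → 2 * (2 + w) + (2 + p) ≡ 4 + p + 2 * w + 1 + 1
    balance = solve-∀
  exponent≡ : n ∸ 2 * (2 + w) ≡ p
  exponent≡ = trans (cong (_∸ 2 * (2 + w)) (split p w)) (m+n∸n≡m p (2 * (2 + w)))
    where
    split : ∀ p w → 4 + p + 2 * w ≡ p + 2 * (2 + w)
    split = solve-∀

recurrence-odd-gap : ∀ p w y → y < fib (1 + p) → Recurrence (5 + p + 2 * w) (2 + p) y
recurrence-odd-gap p w y y<F =
  recurrence-from-ℕ n (2 + p) y t≡ ε≡ exponent≡ (trans (+-identityʳ _) (A-gap-odd p w y y<F))
  where
  n = 5 + p + 2 * w
  t≡ : gapT n (2 + p) ≡ 2 + w
  t≡ = begin
    gapT n (2 + p)                        ≡⟨ cong (λ n → gapT n (2 + p)) (split p w) ⟩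
    gapT ((2 + p) + (3 + 2 * w)) (2 + p)  ≡⟨ gapT-+ (2 + p) (3 + 2 * w) ⟩
    (3 + 2 * w + 2) / 2                   ≡⟨ cong (_/ 2) (halve w) ⟩
    (1 + (2 + w) * 2) / 2                 ≡⟨ [m+kn]/n≡m/n+k 1 (2 + w) 2 ⟩
    2 + w                                 ∎
    where
    open ≡-Reasoning
    split : ∀ p w → 5 + p + 2 * w ≡ (2 + p) + (3 + 2 * w)
    split = solve-∀
    halve : ∀ w → 3 + 2 * w + 2 ≡ 1 + (2 + w) * 2
    halve = solve-∀
  ε≡ : gapε n (2 + p) ≡ + 0
  ε≡ = trans (cong (λ t → + (2 * t) ℤ.- + 1 ℤ.- + n ℤ.+ + (2 + p)) t≡)
             (ℕ-difference→ℤ (2 * (2 + w)) n (2 + p) 0 (balance p w))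
    where
    balance : ∀ p w → 2 * (2 + w) + (2 + p) ≡ 5 + p + 2 * w + 1 + 0
    balance = solve-∀
  exponent≡ : n ∸ 2 * (2 + w) ≡ 1 + p
  exponent≡ = trans (cong (_∸ 2 * (2 + w)) (split p w)) (m+n∸n≡m (1 + p) (2 * (2 + w)))
    where
    split : ∀ p w → 5 + p + 2 * w ≡ (1 + p) + 2 * (2 + w)
    split = solve-∀

recurrence : ∀ n p y → p + 2 ≤ n → 2 ≤ p → y < fib (p ∸ 1) → Recurrence n p y
recurrence n (suc (suc p)) y p+2≤n _ y<F = by-parity (even-or-odd (n ∸ (4 + p)))
  where
  n≡ : 4 + p + (n ∸ (4 + p)) ≡ n
  n≡ = m+[n∸m]≡n (subst (_≤ n) (+-comm (2 + p) 2) p+2≤n)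
  by-parity : ∃[ w ] (n ∸ (4 + p) ≡ 2 * w ⊎ n ∸ (4 + p) ≡ 1 + 2 * w) → Recurrence n (2 + p) y
  by-parity (w , inj₁ d≡2w)   = subst (λ n → Recurrence n (2 + p) y)
    (trans (cong (_+_ (4 + p)) (sym d≡2w)) n≡) (recurrence-even-gap p w y y<F)
  by-parity (w , inj₂ d≡1+2w) = subst (λ n → Recurrence n (2 + p) y)
    (trans (sym (+-suc (4 + p) (2 * w))) (trans (cong (_+_ (4 + p)) (sym d≡1+2w)) n≡))
    (recurrence-odd-gap p w y y<F)

xx-suc : ∀ m k {ℓ} → ℓ ≤ k → xx m k ℓ ≡ fib (m ℓ) + xx m k (suc ℓ)
xx-suc m k {ℓ} ℓ≤k = begin
  sum (map g (upTo (suc k ∸ ℓ)))            ≡⟨ cong (sum ∘′ map g ∘′ upTo) (+-∸-assoc 1 ℓ≤k) ⟩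
  sum (map g (upTo (suc (k ∸ ℓ))))          ≡⟨ sum-upTo-first g (k ∸ ℓ) ⟩
  g 0 + sum (map (g ∘′ suc) (upTo (k ∸ ℓ))) ≡⟨ cong₂ _+_ (cong (fib ∘′ m) (+-identityʳ ℓ))
                                                  (cong sum (map-cong (λ j → cong (fib ∘′ m) (+-suc ℓ j)) (upTo (k ∸ ℓ)))) ⟩
  fib (m ℓ) + xx m k (suc ℓ)                ∎
  where
  open ≡-Reasoning
  g = λ j → fib (m (ℓ + j))

xx-end : ∀ m k → xx m k (suc k) ≡ 0
xx-end m k = cong (λ n → sum (map (λ j → fib (m (suc k + j))) (upTo n))) (n∸n≡0 k)

inhom : (ℕ → ℕ) → ℕ → ℕ
inhom m ℓ = f (tt m (suc ℓ)) * 2 ^ (m ℓ ∸ 2 * tt m (suc ℓ))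

module Zeckendorf (m : ℕ → ℕ) (k : ℕ)
  (gap : ∀ i → 1 ≤ i → i ≤ k → m i + 2 ≤ m (i ∸ 1)) (m[k]≥2 : 2 ≤ m k) where

  gap′ : ∀ {i} → i < k → m (suc i) + 2 ≤ m i
  gap′ i<k = gap (suc _) (s≤s z≤n) i<k

  m≥2 : ∀ {i} → i ≤ k → 2 ≤ m i
  m≥2 i≤k with m≤n⇒m<n∨m≡n i≤k
  ... | inj₁ i<k  = ≤-trans (m≤n+m 2 _) (gap′ i<k)
  ... | inj₂ refl = m[k]≥2

  xx<fib : ∀ {i} → i ≤ k → xx m k (suc i) < fib (m i ∸ 1)
  xx<fib = downward-induction (λ i → xx m k (suc i) < fib (m i ∸ 1)) last step
    where
    last : xx m k (suc k) < fib (m k ∸ 1)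
    last = subst (_< fib (m k ∸ 1)) (sym (xx-end m k)) (0<fib[M∸1] m[k]≥2)
      where
      0<fib[M∸1] : ∀ {M} → 2 ≤ M → 0 < fib (M ∸ 1)
      0<fib[M∸1] {suc (suc M)} _ = fib-pos M
      0<fib[M∸1] {1} (s≤s ())
    step : ∀ {i} → i < k → xx m k (2 + i) < fib (m (suc i) ∸ 1) → xx m k (suc i) < fib (m i ∸ 1)
    step {i} i<k tail<F = begin-strict
      xx m k (suc i)                  ≡⟨ xx-suc m k i<k ⟩
      fib (m (suc i)) + xx m k (2 + i) <⟨ fib-tail (≤-trans (s≤s z≤n) (m≥2 i<k)) tail<F ⟩
      fib (suc (m (suc i)))           ≤⟨ fib-mono (+2≤⇒<∸1 (gap′ i<k)) ⟩
      fib (m i ∸ 1)                   ∎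
      where open ≤-Reasoning

  A-xx-step : ∀ ℓ → ℓ < k → + A (xx m k ℓ) ≡
    + tt m (suc ℓ) ℤ.* + A (xx m k (suc ℓ)) ℤ.- eps m (suc ℓ) ℤ.* + A (xx m k (2 + ℓ)) ℤ.+ + inhom m ℓ
  A-xx-step ℓ ℓ<k = begin
    + A (xx m k ℓ)
      ≡⟨ cong (λ x → + A x) (trans (xx-suc m k (<⇒≤ ℓ<k)) (cong (_+_ (fib (m ℓ))) x₁≡)) ⟩
    + A (fib (m ℓ) + (fib (m (suc ℓ)) + y))
      ≡⟨ recurrence (m ℓ) (m (suc ℓ)) y (gap′ ℓ<k) (m≥2 {suc ℓ} ℓ<k) (xx<fib {suc ℓ} ℓ<k) ⟩
    + tt m (suc ℓ) ℤ.* + A (fib (m (suc ℓ)) + y) ℤ.- eps m (suc ℓ) ℤ.* + A y ℤ.+ + inhom m ℓ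
      ≡⟨ cong (λ x → + tt m (suc ℓ) ℤ.* + A x ℤ.- eps m (suc ℓ) ℤ.* + A y ℤ.+ + inhom m ℓ) (sym x₁≡) ⟩
    + tt m (suc ℓ) ℤ.* + A (xx m k (suc ℓ)) ℤ.- eps m (suc ℓ) ℤ.* + A y ℤ.+ + inhom m ℓ ∎
    where
    open ≡-Reasoning
    y = xx m k (2 + ℓ)
    x₁≡ : xx m k (suc ℓ) ≡ fib (m (suc ℓ)) + y
    x₁≡ = xx-suc m k ℓ<k

  A-xx-last : A (xx m k k) ≡ base (m k)
  A-xx-last = begin
    A (xx m k k)                      ≡⟨ cong A (xx-suc m k ≤-refl) ⟩
    A (fib (m k) + xx m k (suc k))    ≡⟨ cong (λ x → A (fib (m k) + x)) (xx-end m k) ⟩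
    A (fib (m k) + 0)                 ≡⟨ cong A (+-identityʳ (fib (m k))) ⟩
    A (fib (m k))                     ≡⟨ A-fib (m k) m[k]≥2 ⟩
    base (m k)                        ∎
    where open ≡-Reasoning

-- SS sums with a where-bound function of Defs, which cannot be named here; once the summed
-- list is abstracted, that function is the solution of the hole in foldr-universal.
SS≡foldr : ∀ m ℓ → SS m ℓ ≡ foldr ℤ._+_ (+ 0) (map (λ j → aa m j ℤ.* + inhom m j) (upTo ℓ))
SS≡foldr m ℓ with map (λ j → aa m j ℤ.* + inhom m j) (upTo ℓ)
                | foldr-universal _ ℤ._+_ (+ 0) refl (λ _ _ → refl)
... | zs | universal = universal zs

SS-suc : ∀ m ℓ → SS m (suc ℓ) ≡ SS m ℓ ℤ.+ aa m ℓ ℤ.* + inhom m ℓ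
SS-suc m ℓ = begin
  SS m (suc ℓ)                                     ≡⟨ SS≡foldr m (suc ℓ) ⟩
  foldr ℤ._+_ (+ 0) (map T (upTo (suc ℓ)))         ≡⟨ cong (foldr ℤ._+_ (+ 0) ∘′ map T) (sym (upTo-∷ʳ ℓ)) ⟩
  foldr ℤ._+_ (+ 0) (map T (upTo ℓ ++ [ ℓ ]))      ≡⟨ cong (foldr ℤ._+_ (+ 0)) (map-++ T (upTo ℓ) [ ℓ ]) ⟩
  foldr ℤ._+_ (+ 0) (map T (upTo ℓ) ++ [ T ℓ ])    ≡⟨ foldr-+-∷ʳ (map T (upTo ℓ)) (T ℓ) ⟩
  foldr ℤ._+_ (+ 0) (map T (upTo ℓ)) ℤ.+ T ℓ       ≡⟨ cong (ℤ._+ T ℓ) (sym (SS≡foldr m ℓ)) ⟩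
  SS m ℓ ℤ.+ T ℓ                                   ∎
  where
  open ≡-Reasoning
  T = λ j → aa m j ℤ.* + inhom m j

unroll-recurrence : ∀ m k (X : ℕ → ℤ) →
  (∀ ℓ → ℓ < k → X ℓ ≡ + tt m (suc ℓ) ℤ.* X (suc ℓ) ℤ.- eps m (suc ℓ) ℤ.* X (2 + ℓ) ℤ.+ + inhom m ℓ) →
  ∀ j → j < k → X 0 ≡ aa m (suc j) ℤ.* X (suc j) ℤ.- eps m (suc j) ℤ.* aa m j ℤ.* X (2 + j) ℤ.+ SS m (suc j)
unroll-recurrence m k X rec zero 0<k =
  trans (rec 0 0<k) (first-step (+ tt m 1) (X 1) (eps m 1) (X 2) (+ inhom m 0))
  where
  first-step : ∀ t x₁ e x₂ Q →
    t ℤ.* x₁ ℤ.- e ℤ.* x₂ ℤ.+ Q ≡ t ℤ.* x₁ ℤ.- e ℤ.* + 1 ℤ.* x₂ ℤ.+ (+ 1 ℤ.* Q ℤ.+ + 0)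
  first-step = ℤsolve-∀
unroll-recurrence m k X rec (suc j) j+1<k = begin
  X 0
    ≡⟨ unroll-recurrence m k X rec j (<-trans (n<1+n j) j+1<k) ⟩
  a₁ ℤ.* X (1 + j) ℤ.- eps m (1 + j) ℤ.* a₀ ℤ.* X (2 + j) ℤ.+ SS m (1 + j)
    ≡⟨ cong (λ x → a₁ ℤ.* x ℤ.- eps m (1 + j) ℤ.* a₀ ℤ.* X (2 + j) ℤ.+ SS m (1 + j)) (rec (suc j) j+1<k) ⟩
  a₁ ℤ.* (+ tt m (2 + j) ℤ.* X (2 + j) ℤ.- eps m (2 + j) ℤ.* X (3 + j) ℤ.+ Q)
    ℤ.- eps m (1 + j) ℤ.* a₀ ℤ.* X (2 + j) ℤ.+ SS m (1 + j)
    ≡⟨ substitute a₁ a₀ (eps m (1 + j)) (+ tt m (2 + j)) (eps m (2 + j)) (X (2 + j)) (X (3 + j)) Q (SS m (1 + j)) ⟩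
  aa m (2 + j) ℤ.* X (2 + j) ℤ.- eps m (2 + j) ℤ.* a₁ ℤ.* X (3 + j) ℤ.+ (SS m (1 + j) ℤ.+ a₁ ℤ.* Q)
    ≡⟨ cong (λ s → aa m (2 + j) ℤ.* X (2 + j) ℤ.- eps m (2 + j) ℤ.* a₁ ℤ.* X (3 + j) ℤ.+ s) (sym (SS-suc m (1 + j))) ⟩
  aa m (2 + j) ℤ.* X (2 + j) ℤ.- eps m (2 + j) ℤ.* a₁ ℤ.* X (3 + j) ℤ.+ SS m (2 + j) ∎
  where
  open ≡-Reasoning
  a₁ = aa m (1 + j)
  a₀ = aa m j
  Q = + inhom m (1 + j)
  substitute : ∀ a₁ a₀ e₁ t₂ e₂ x₂ x₃ Q S →
    a₁ ℤ.* (t₂ ℤ.* x₂ ℤ.- e₂ ℤ.* x₃ ℤ.+ Q) ℤ.- e₁ ℤ.* a₀ ℤ.* x₂ ℤ.+ S ≡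
    (t₂ ℤ.* a₁ ℤ.- e₁ ℤ.* a₀) ℤ.* x₂ ℤ.- e₂ ℤ.* a₁ ℤ.* x₃ ℤ.+ (S ℤ.+ a₁ ℤ.* Q)
  substitute = ℤsolve-∀

theorem1p2 : (H k : ℕ) (m : ℕ → ℕ) →
    (∀ i → 1 ≤ i → i ≤ k → m i + 2 ≤ m (i ∸ 1)) →
    2 ≤ m k →
    H ≡ zeckSum m k →
    ((ℓ : ℕ) → 1 ≤ ℓ → ℓ ≤ k →
      + A H ≡ aa m ℓ ℤ.* + A (xx m k ℓ) ℤ.- eps m ℓ ℤ.* aa m (ℓ ∸ 1) ℤ.* + A (xx m k (suc ℓ)) ℤ.+ SS m ℓ)
    × (1 ≤ k → + A H ≡ aa m k ℤ.* + base (m k) ℤ.- eps m k ℤ.* aa m (k ∸ 1) ℤ.+ SS m k)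
    × (k ≡ 0 → A H ≡ base (m 0))
theorem1p2 H k m gap m[k]≥2 refl = at-ℓ , at-k , single-term
  where
  open Zeckendorf m k gap m[k]≥2
  at-ℓ : (ℓ : ℕ) → 1 ≤ ℓ → ℓ ≤ k →
    + A H ≡ aa m ℓ ℤ.* + A (xx m k ℓ) ℤ.- eps m ℓ ℤ.* aa m (ℓ ∸ 1) ℤ.* + A (xx m k (suc ℓ)) ℤ.+ SS m ℓ
  at-ℓ (suc j) _ j<k = unroll-recurrence m k (λ ℓ → + A (xx m k ℓ)) A-xx-step j j<k
  at-k : 1 ≤ k → + A H ≡ aa m k ℤ.* + base (m k) ℤ.- eps m k ℤ.* aa m (k ∸ 1) ℤ.+ SS m k
  at-k 1≤k = trans (at-ℓ k 1≤k ≤-refl)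
    (cong₂ (λ x εa → aa m k ℤ.* + x ℤ.- εa ℤ.+ SS m k) A-xx-last
           (trans (cong (λ x → eps m k ℤ.* aa m (k ∸ 1) ℤ.* + A x) (xx-end m k)) (ℤP.*-identityʳ _)))
  single-term : k ≡ 0 → A H ≡ base (m 0)
  single-term k≡0 = trans (cong (λ i → A (xx m k i)) (sym k≡0)) (trans A-xx-last (cong (base ∘′ m) k≡0))
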